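{- Let $p$ be an odd prime and let $u$ and $v$ be $n$-dimensional integral column vectors each of whose entries is nonzero modulo $p$. Suppose that (i) $u$ and $v$ are linearly dependent over $\mathbb{F}_p$; (ii) $u\neq \pm v$; and (iii) $u^{\mathrm T}u=v^{\mathrm T}v=p^2$. Then $u^{\mathrm T}v=0$.
   Context: $\mathbb{F}_p=\mathbb{Z}/p\mathbb{Z}$; linear dependence over $\mathbb{F}_p$ refers to the reductions of $u,v$ modulo $p$. -}

module Defs where

open import Data.Nat using (ℕ; zero; suc)
open import Data.Nat.Primality using (Prime)
open import Data.Integer using (ℤ; +_; _+_; _*_; -_)
open import Data.Integer.Divisibility using (_∣_)
open import Data.Fin using (Fin)
open import Data.Vec using (Vec; []; _∷_; lookup; map; zipWith; foldr)
open import Data.Product using (Σ; _×_)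
open import Data.Sum using (_⊎_)
open import Relation.Nullary using (¬_)
open import Relation.Binary.PropositionalEquality using (_≡_)

IVec : ℕ → Set
IVec n = Vec ℤ n

dot : ∀ {n} → IVec n → IVec n → ℤ
dot []       []       = + 0
dot (x ∷ xs) (y ∷ ys) = x * y + dot xs ys

neg : ∀ {n} → IVec n → IVec n
neg u = map -_ u

_≡0mod_ : ℤ → ℕ → Set
x ≡0mod p = (+ p) ∣ x

AllEntriesNonzeroMod : ∀ {n} → ℕ → IVec n → Set
AllEntriesNonzeroMod p u = ∀ i → ¬ (lookup u i ≡0mod p)

-- The reductions of u and v modulo p are linearly dependent over F_p:
-- there are scalars a, b (integers representing elements of F_p), not both
-- zero in F_p, with a·u + b·v ≡ 0 (mod p) entrywise.
LinDepModP : ∀ {n} → ℕ → IVec n → IVec n → Set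
LinDepModP p u v =
  Σ ℤ λ a → Σ ℤ λ b →
    (¬ (a ≡0mod p) ⊎ ¬ (b ≡0mod p)) ×
    (∀ i → (a * lookup u i + b * lookup v i) ≡0mod p)

-- Write w = a·u + b·v for the F_p-dependence; every entry of w is divisible by p, so p² divides
-- w·w = a²u·u + 2ab·u·v + b²v·v, and as u·u = v·v = p² this gives p² ∣ 2ab·u·v. The dependence
-- forces p ∤ a and p ∤ b, and p is odd, so p² ∣ u·v. Finally u·v = kp² with u ≠ ±v is only
-- possible for k = 0, because (u ∓ v)·(u ∓ v) = 2p²(1 ∓ k) must be positive.
module Submission where

open import Defs
open import Data.Nat using (ℕ; zero; suc; z≤n)
open import Data.Nat.Primality using (Prime; euclidsLemma; prime⇒irreducible; prime⇒nonZero; prime[2]; ¬prime[1])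
import Data.Nat.Divisibility as ℕ
import Data.Integer as ℤ
open import Data.Integer
  using (ℤ; +_; -[1+_]; +[1+_]; _+_; _-_; _*_; -_; _^_; _≤_; _<_; 0ℤ; 1ℤ; -1ℤ; +≤+; +<+; nonNegative)
open import Data.Integer.Properties
  using (abs-*; *-identityʳ; *-identityˡ; -1*i≡-i; i-j≡0⇒i≡j; i*j≡0⇒i≡0∨j≡0; ≤-antisym; ≤∧≢⇒<; *-assoc;
         +-mono-≤; i≤i+j; i≤j+i; *-cancelʳ-<-nonNeg)
open import Data.Integer.Divisibility.Signed
  using (_∣_; divides; ∣ᵤ⇒∣; ∣⇒∣ᵤ; ∣-refl; ∣-trans; ∣-reflexive; ∣m∣n⇒∣m+n; ∣n⇒∣m*n; ∣m+n∣n⇒∣m; ∣m+n∣m⇒∣n; ∣m⇒∣m*n;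
         *-monoʳ-∣; *-monoˡ-∣; *-cancelʳ-∣)
open import Data.Integer.Tactic.RingSolver using (solve-∀)
open import Data.Vec using ([]; _∷_; lookup; map; zipWith; replicate)
open import Data.Vec.Properties using (map-id; map-cong; lookup-zipWith; ∷-injective)
open import Data.Fin using (zero; suc)
open import Data.Product using (_×_; _,_)
open import Data.Sum using (_⊎_; inj₁; inj₂; [_,_]′)
import Data.Sum as Sum
open import Data.Empty using (⊥-elim)
open import Function using (id; _∘_)
open import Relation.Nullary using (¬_)
open import Relation.Binary.PropositionalEquality
  using (_≡_; _≢_; refl; sym; trans; cong; cong₂; subst; module ≡-Reasoning)

open ≡-Reasoning

euclidsLemma-ℤ : ∀ {p} → Prime p → ∀ i j → + p ∣ i * j → + p ∣ i ⊎ + p ∣ j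
euclidsLemma-ℤ pr i j p∣ij =
  Sum.map ∣ᵤ⇒∣ ∣ᵤ⇒∣ (euclidsLemma ℤ.∣ i ∣ ℤ.∣ j ∣ pr (ℕ.∣-trans (∣⇒∣ᵤ p∣ij) (ℕ.∣-reflexive (abs-* i j))))

prime∤* : ∀ {p} → Prime p → ∀ {i j} → ¬ + p ∣ i → ¬ + p ∣ j → ¬ + p ∣ i * j
prime∤* pr {i} {j} p∤i p∤j p∣ij = [ p∤i , p∤j ]′ (euclidsLemma-ℤ pr i j p∣ij)

odd-prime∤2 : ∀ {p} → Prime p → p ≢ 2 → ¬ + p ∣ + 2
odd-prime∤2 pr p≢2 p∣2 with prime⇒irreducible prime[2] (∣⇒∣ᵤ p∣2)
... | inj₁ refl = ¬prime[1] pr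
... | inj₂ p≡2  = p≢2 p≡2

coefficients-nonzero : ∀ {p} → Prime p → ∀ {a b x y} → + p ∣ a * x + b * y →
  ¬ + p ∣ x → ¬ + p ∣ y → ¬ + p ∣ a ⊎ ¬ + p ∣ b → ¬ + p ∣ a × ¬ + p ∣ b
coefficients-nonzero {p} pr {b = b} {y = y} p∣ax+by p∤x p∤y (inj₁ p∤a) = p∤a , p∤b
  where
  p∤b : ¬ + p ∣ b
  p∤b p∣b = prime∤* pr p∤a p∤x (∣m+n∣n⇒∣m p∣ax+by (∣m⇒∣m*n y p∣b))
coefficients-nonzero {p} pr {a = a} {x = x} p∣ax+by p∤x p∤y (inj₂ p∤b) = p∤a , p∤b
  where
  p∤a : ¬ + p ∣ a
  p∤a p∣a = prime∤* pr p∤b p∤y (∣m+n∣m⇒∣n p∣ax+by (∣m⇒∣m*n x p∣a))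

prime²-divisor : ∀ {p} → Prime p → ∀ {m i} → ¬ + p ∣ m → + p * + p ∣ m * i → + p * + p ∣ i
prime²-divisor {p} pr {m} {i} p∤m p²∣mi with euclidsLemma-ℤ pr m i (∣-trans (∣m⇒∣m*n (+ p) ∣-refl) p²∣mi)
... | inj₁ p∣m = ⊥-elim (p∤m p∣m)
... | inj₂ (divides j refl) = *-monoˡ-∣ (+ p) p∣j
  where
  p∣mj : + p ∣ m * j
  p∣mj = *-cancelʳ-∣ (+ p) {{prime⇒nonZero pr}} (∣-trans p²∣mi (∣-reflexive (sym (*-assoc m j (+ p)))))
  p∣j : + p ∣ j
  p∣j = [ ⊥-elim ∘ p∤m , id ]′ (euclidsLemma-ℤ pr m j p∣mj)

∣-entries⇒square∣dot-self : ∀ {n d} (w : IVec n) → (∀ i → d ∣ lookup w i) → d * d ∣ dot w w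
∣-entries⇒square∣dot-self []      _   = divides 0ℤ refl
∣-entries⇒square∣dot-self {d = d} (x ∷ w) d∣w =
  ∣m∣n⇒∣m+n (∣-trans (*-monoˡ-∣ d (d∣w zero)) (*-monoʳ-∣ x (d∣w zero)))
            (∣-entries⇒square∣dot-self w (d∣w ∘ suc))

lincomb : ∀ {n} → ℤ → ℤ → IVec n → IVec n → IVec n
lincomb a b = zipWith (λ x y → a * x + b * y)

dot-lincomb-self : ∀ {n} a b (u v : IVec n) → dot (lincomb a b u v) (lincomb a b u v)
  ≡ a * a * dot u u + + 2 * a * b * dot u v + b * b * dot v v
dot-lincomb-self a b [] [] = empty a b
  where
  empty : ∀ a b → 0ℤ ≡ a * a * 0ℤ + + 2 * a * b * 0ℤ + b * b * 0ℤ
  empty = solve-∀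
dot-lincomb-self a b (x ∷ u) (y ∷ v) = begin
  (a * x + b * y) * (a * x + b * y) + dot (lincomb a b u v) (lincomb a b u v)
    ≡⟨ cong (λ t → (a * x + b * y) * (a * x + b * y) + t) (dot-lincomb-self a b u v) ⟩
  (a * x + b * y) * (a * x + b * y) + (a * a * dot u u + + 2 * a * b * dot u v + b * b * dot v v)
    ≡⟨ expand a b x y (dot u u) (dot u v) (dot v v) ⟩
  a * a * (x * x + dot u u) + + 2 * a * b * (x * y + dot u v) + b * b * (y * y + dot v v) ∎
  where
  expand : ∀ a b x y U W V →
    (a * x + b * y) * (a * x + b * y) + (a * a * U + + 2 * a * b * W + b * b * V)
      ≡ a * a * (x * x + U) + + 2 * a * b * (x * y + W) + b * b * (y * y + V)
  expand = solve-∀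

dot-lincomb-self-equal-norms : ∀ {n M} a b (u v : IVec n) → dot u u ≡ M → dot v v ≡ M →
  dot (lincomb a b u v) (lincomb a b u v) ≡ (a * a + b * b) * M + + 2 * a * b * dot u v
dot-lincomb-self-equal-norms {M = M} a b u v u·u≡M v·v≡M = begin
  dot (lincomb a b u v) (lincomb a b u v)
    ≡⟨ dot-lincomb-self a b u v ⟩
  a * a * dot u u + + 2 * a * b * dot u v + b * b * dot v v
    ≡⟨ cong₂ (λ U V → a * a * U + + 2 * a * b * dot u v + b * b * V) u·u≡M v·v≡M ⟩
  a * a * M + + 2 * a * b * dot u v + b * b * M
    ≡⟨ regroup a b (dot u v) M ⟩
  (a * a + b * b) * M + + 2 * a * b * dot u v ∎
  where
  regroup : ∀ a b W M → a * a * M + + 2 * a * b * W + b * b * M ≡ (a * a + b * b) * M + + 2 * a * b * W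
  regroup = solve-∀

0≤i*i : ∀ i → 0ℤ ≤ i * i
0≤i*i (+ zero)  = +≤+ z≤n
0≤i*i +[1+ n ]  = +≤+ z≤n
0≤i*i -[1+ n ]  = +≤+ z≤n

0≤dot-self : ∀ {n} (w : IVec n) → 0ℤ ≤ dot w w
0≤dot-self []      = +≤+ z≤n
0≤dot-self (x ∷ w) = +-mono-≤ (0≤i*i x) (0≤dot-self w)

0≤i∧0≤j∧i+j≡0⇒i≡0∧j≡0 : ∀ {i j} → 0ℤ ≤ i → 0ℤ ≤ j → i + j ≡ 0ℤ → i ≡ 0ℤ × j ≡ 0ℤ
0≤i∧0≤j∧i+j≡0⇒i≡0∧j≡0 {i} {j} 0≤i 0≤j i+j≡0 =
  ≤-antisym (subst (i ≤_) i+j≡0 (i≤i+j i j {{nonNegative 0≤j}})) 0≤i ,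
  ≤-antisym (subst (j ≤_) i+j≡0 (i≤j+i j i {{nonNegative 0≤i}})) 0≤j

dot-self≡0⇒≡0 : ∀ {n} (w : IVec n) → dot w w ≡ 0ℤ → w ≡ replicate n 0ℤ
dot-self≡0⇒≡0 []      _ = refl
dot-self≡0⇒≡0 (x ∷ w) x*x+w·w≡0
  with x*x≡0 , w·w≡0 ← 0≤i∧0≤j∧i+j≡0⇒i≡0∧j≡0 (0≤i*i x) (0≤dot-self w) x*x+w·w≡0 =
  cong₂ _∷_ ([ id , id ]′ (i*j≡0⇒i≡0∨j≡0 x x*x≡0)) (dot-self≡0⇒≡0 w w·w≡0)

0<dot-self : ∀ {n} (w : IVec n) → w ≢ replicate n 0ℤ → 0ℤ < dot w w
0<dot-self w w≢0 = ≤∧≢⇒< (0≤dot-self w) (λ 0≡w·w → w≢0 (dot-self≡0⇒≡0 w (sym 0≡w·w)))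

lincomb≡0⇒≡scaled : ∀ {n} c (u v : IVec n) → lincomb 1ℤ (- c) u v ≡ replicate n 0ℤ → u ≡ map (c *_) v
lincomb≡0⇒≡scaled c []      []      _  = refl
lincomb≡0⇒≡scaled c (x ∷ u) (y ∷ v) eq with head , tail ← ∷-injective eq =
  cong₂ _∷_ (i-j≡0⇒i≡j x (c * y) (trans (rearrange c x y) head)) (lincomb≡0⇒≡scaled c u v tail)
  where
  rearrange : ∀ c x y → x - c * y ≡ 1ℤ * x + - c * y
  rearrange = solve-∀

0<1+i∧0<1-i⇒i≡0 : ∀ i → 0ℤ < 1ℤ + i → 0ℤ < 1ℤ - i → i ≡ 0ℤ
0<1+i∧0<1-i⇒i≡0 (+ zero)          _         _         = refl
0<1+i∧0<1-i⇒i≡0 +[1+ zero ]       _         (+<+ ())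
0<1+i∧0<1-i⇒i≡0 +[1+ suc n ]      _         ()
0<1+i∧0<1-i⇒i≡0 -[1+ zero ]       (+<+ ())  _
0<1+i∧0<1-i⇒i≡0 -[1+ suc n ]      ()        _

equal-norms∧∣⇒orthogonal : ∀ {n M} (u v : IVec n) → dot u u ≡ M → dot v v ≡ M →
  M ∣ dot u v → u ≢ v → u ≢ neg v → dot u v ≡ 0ℤ
equal-norms∧∣⇒orthogonal {M = M} u v u·u≡M v·v≡M (divides k u·v≡kM) u≢v u≢-v = begin
  dot u v ≡⟨ u·v≡kM ⟩
  k * M   ≡⟨ cong (_* M) (0<1+i∧0<1-i⇒i≡0 k 0<1+k 0<1-k) ⟩
  0ℤ      ∎
  where
  0≤M+M : 0ℤ ≤ M + M
  0≤M+M = subst (λ m → 0ℤ ≤ m + m) u·u≡M (+-mono-≤ (0≤dot-self u) (0≤dot-self u))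

  0<norm-of-difference : ∀ c → u ≢ map (c *_) v →
    0ℤ < (1ℤ * 1ℤ + - c * - c) * M + + 2 * 1ℤ * - c * (k * M)
  0<norm-of-difference c u≢cv =
    subst (0ℤ <_) (trans (dot-lincomb-self-equal-norms 1ℤ (- c) u v u·u≡M v·v≡M)
                         (cong (λ W → (1ℤ * 1ℤ + - c * - c) * M + + 2 * 1ℤ * - c * W) u·v≡kM))
      (0<dot-self (lincomb 1ℤ (- c) u v) (u≢cv ∘ lincomb≡0⇒≡scaled c u v))

  factor-minus : ∀ k M → (1ℤ * 1ℤ + - 1ℤ * - 1ℤ) * M + + 2 * 1ℤ * - 1ℤ * (k * M) ≡ (1ℤ - k) * (M + M)
  factor-minus = solve-∀

  factor-plus : ∀ k M → (1ℤ * 1ℤ + - -1ℤ * - -1ℤ) * M + + 2 * 1ℤ * - -1ℤ * (k * M) ≡ (1ℤ + k) * (M + M)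
  factor-plus = solve-∀

  0<1-k : 0ℤ < 1ℤ - k
  0<1-k = *-cancelʳ-<-nonNeg (M + M) {{nonNegative 0≤M+M}}
    (subst (0ℤ <_) (factor-minus k M)
      (0<norm-of-difference 1ℤ (λ u≡1v → u≢v (trans u≡1v (trans (map-cong *-identityˡ v) (map-id v))))))

  0<1+k : 0ℤ < 1ℤ + k
  0<1+k = *-cancelʳ-<-nonNeg (M + M) {{nonNegative 0≤M+M}}
    (subst (0ℤ <_) (factor-plus k M)
      (0<norm-of-difference -1ℤ (λ u≡-v → u≢-v (trans u≡-v (map-cong -1*i≡-i v)))))

lemma2p14 : (p : ℕ) → Prime p → ¬ (p ≡ 2) →
    (n : ℕ) → (u v : IVec n) →
    AllEntriesNonzeroMod p u → AllEntriesNonzeroMod p v →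
    LinDepModP p u v →
    ¬ (u ≡ v) → ¬ (u ≡ neg v) →
    dot u u ≡ (+ p) ^ 2 → dot v v ≡ (+ p) ^ 2 →
    dot u v ≡ + 0
lemma2p14 p pr p≢2 zero [] [] _ _ _ u≢v _ _ _ = ⊥-elim (u≢v refl)
lemma2p14 p pr p≢2 (suc n) u v p∤u p∤v (a , b , p∤a∨p∤b , p∣au+bv) u≢v u≢-v u·u≡p² v·v≡p² =
  equal-norms∧∣⇒orthogonal u v u·u≡p*p v·v≡p*p p*p∣u·v u≢v u≢-v
  where
  P : ℤ
  P = + p

  u·u≡p*p : dot u u ≡ P * P
  u·u≡p*p = trans u·u≡p² (cong (P *_) (*-identityʳ P))

  v·v≡p*p : dot v v ≡ P * P
  v·v≡p*p = trans v·v≡p² (cong (P *_) (*-identityʳ P))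

  w : IVec (suc n)
  w = lincomb a b u v

  p∣w : ∀ i → P ∣ lookup w i
  p∣w i = subst (P ∣_) (sym (lookup-zipWith _ i u v)) (∣ᵤ⇒∣ (p∣au+bv i))

  p∤ab : ¬ P ∣ a × ¬ P ∣ b
  p∤ab = coefficients-nonzero pr (∣ᵤ⇒∣ (p∣au+bv zero)) (p∤u zero ∘ ∣⇒∣ᵤ) (p∤v zero ∘ ∣⇒∣ᵤ)
           (Sum.map (_∘ ∣⇒∣ᵤ) (_∘ ∣⇒∣ᵤ) p∤a∨p∤b)

  p*p∣2ab·u·v : P * P ∣ + 2 * a * b * dot u v
  p*p∣2ab·u·v = ∣m+n∣m⇒∣n
    (subst (P * P ∣_) (dot-lincomb-self-equal-norms a b u v u·u≡p*p v·v≡p*p) (∣-entries⇒square∣dot-self w p∣w))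
    (∣n⇒∣m*n (a * a + b * b) ∣-refl)

  p*p∣u·v : P * P ∣ dot u v
  p*p∣u·v with p∤a , p∤b ← p∤ab =
    prime²-divisor pr (prime∤* pr (prime∤* pr (odd-prime∤2 pr p≢2) p∤a) p∤b) p*p∣2ab·u·v
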